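{- Let $\Gamma$ be a distance-regular graph with diameter $D\ge3$ and fix a vertex $x$. For $0\le i\le D-1$, $$E^*_{i+1}A_iE^*_1-E^*_iA_{i+1}E^*_1=\sum_{h=0}^iA_hE^*_1-\sum_{h=0}^iE^*_hJE^*_1.$$
   Context: $\Gamma=(X,R)$ is a finite connected distance-regular graph with path-length distance $\partial$ and diameter $D$. For $0\le i\le D$, $A_i$ is the $i$th distance matrix ($yz$-entry $1$ if $\partial(y,z)=i$, else $0$), with $A_i=0$ for $i<0$ or $i>D$. $J$ is the all-ones matrix. $E^*_i$ is the diagonal matrix with $yy$-entry $1$ if $\partial(x,y)=i$, else $0$, with $E^*_i=0$ for $i<0$ or $i>D$. -}

module Defs where

open import Data.Nat as ℕ using (ℕ; zero; suc; _≤_; _<_)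
open import Data.Nat.Properties using (_≟_)
open import Data.Fin as Fin using (Fin)
import Data.Fin.Properties as FinP
open import Data.Bool using (Bool; true; false; _∧_; _∨_; if_then_else_)
open import Data.Integer as ℤ using (ℤ; 0ℤ; 1ℤ)
open import Data.Product using (Σ; ∃; _×_; _,_)
open import Relation.Nullary.Decidable using (⌊_⌋)
open import Relation.Binary.PropositionalEquality using (_≡_)

sumℤ : {n : ℕ} → (Fin n → ℤ) → ℤ
sumℤ {zero}  f = 0ℤ
sumℤ {suc n} f = f Fin.zero ℤ.+ sumℤ (λ k → f (Fin.suc k))

sumℕ : {n : ℕ} → (Fin n → ℕ) → ℕ
sumℕ {zero}  f = 0
sumℕ {suc n} f = f Fin.zero ℕ.+ sumℕ (λ k → f (Fin.suc k))

anyFin : {n : ℕ} → (Fin n → Bool) → Bool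
anyFin {zero}  f = false
anyFin {suc n} f = f Fin.zero ∨ anyFin (λ k → f (Fin.suc k))

record Graph : Set where
  field
    n      : ℕ
    Adj    : Fin n → Fin n → Bool
    sym    : ∀ y z → Adj y z ≡ Adj z y
    irrefl : ∀ y → Adj y y ≡ false

module _ (Γ : Graph) where
  open Graph Γ

  walk : ℕ → Fin n → Fin n → Bool
  walk zero    y z = ⌊ y FinP.≟ z ⌋
  walk (suc k) y z = anyFin (λ w → Adj y w ∧ walk k w z)

  Connected : Set
  Connected = ∀ y z → ∃ λ k → walk k y z ≡ true

  -- least k in [start, start + fuel) with p k = true (returns start + fuel if none)
  search : (ℕ → Bool) → ℕ → ℕ → ℕ
  search p start zero       = start
  search p start (suc fuel) = if p start then start else search p (suc start) fuel

  -- path-length distance: least length of a walk from y to z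
  -- (for a connected graph a shortest walk has length < n, so the search is exact)
  dist : Fin n → Fin n → ℕ
  dist y z = search (λ k → walk k y z) 0 n

  IsDiameter : ℕ → Set
  IsDiameter D = (∀ y z → dist y z ≤ D) × (∃ λ y → ∃ λ z → dist y z ≡ D)

  pcount : ℕ → ℕ → Fin n → Fin n → ℕ
  pcount i j y z =
    sumℕ (λ w → if ⌊ dist y w ≟ i ⌋ ∧ ⌊ dist w z ≟ j ⌋ then 1 else 0)

  DistanceRegular : Set
  DistanceRegular =
    Connected ×
    (∀ h i j (y z y' z' : Fin n) → dist y z ≡ h → dist y' z' ≡ h →
       pcount i j y z ≡ pcount i j y' z')

  Mat : Set
  Mat = Fin n → Fin n → ℤ

  _·_ : Mat → Mat → Mat
  (M · N) y z = sumℤ (λ w → M y w ℤ.* N w z)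

  _⊕_ : Mat → Mat → Mat
  (M ⊕ N) y z = M y z ℤ.+ N y z

  _⊖_ : Mat → Mat → Mat
  (M ⊖ N) y z = M y z ℤ.- N y z

  𝟘 : Mat
  𝟘 y z = 0ℤ

  sumTo : ℕ → (ℕ → Mat) → Mat
  sumTo zero    M = M 0
  sumTo (suc i) M = sumTo i M ⊕ M (suc i)

  -- i-th distance matrix (automatically 0 for i > D)
  A : ℕ → Mat
  A i y z = if ⌊ dist y z ≟ i ⌋ then 1ℤ else 0ℤ

  J : Mat
  J y z = 1ℤ

  -- dual idempotent E*_i with respect to base vertex x (0 for i > D)
  Estar : Fin n → ℕ → Mat
  Estar x i y z = if ⌊ y FinP.≟ z ⌋ ∧ ⌊ dist x y ≟ i ⌋ then 1ℤ else 0ℤ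

{-# OPTIONS --safe #-}
-- Multiplying by E*_1 on the right keeps only the entries (y, z) with z adjacent to x.
-- For such z the distances a = ∂(x,y) and b = ∂(y,z) differ by at most one, so the entry
-- [b ≤ i] − [a ≤ i] of the right-hand side is nonzero only where the threshold i is crossed,
-- namely at (a, b) = (i+1, i) and (a, b) = (i, i+1): these are the entries of the left-hand side.
module Submission where

open import Defs
open import Data.Nat using (ℕ; zero; suc; _+_; _≤_; _<_; z≤n; s≤s)
open import Data.Nat.Properties
  using (_≟_; _≤?_; ≤-refl; ≤-reflexive; ≤-trans; ≤-antisym; ≤-pred; <-cmp; <⇒≤; <⇒≢; >⇒≢; <⇒≱;
         1+n≰n; n<1+n; n≤1+n; m<n⇒m<1+n; m≤n⇒m<n∨m≡n; <-trans)
import Data.Nat.Properties as ℕ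
open import Data.Fin as Fin using (Fin)
import Data.Fin.Properties as Fin
open import Data.Bool using (Bool; true; false; _∧_; if_then_else_)
open import Data.Bool.Properties using (∨-zeroʳ; ∧-conicalˡ; ∧-conicalʳ; ⇔→≡)
open import Data.Integer as ℤ using (ℤ; 0ℤ; 1ℤ; _-_)
open import Data.Integer.Properties
  using (*-comm; *-identityʳ; *-zeroʳ; *-distribʳ-+; +-identityˡ; +-identityʳ; +-inverseʳ; i≡j⇒i-j≡0)
open import Data.Product using (∃; _×_; _,_; uncurry)
open import Data.Sum using (inj₁; inj₂)
open import Data.Empty using (⊥-elim)
open import Function using (_∘_)
open import Function.Bundles using (mk⇔)
open import Relation.Binary.Definitions using (tri<; tri≈; tri>)
open import Relation.Binary.PropositionalEquality
  using (_≡_; _≢_; refl; sym; trans; cong; cong₂; subst; module ≡-Reasoning)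
open import Relation.Nullary using (¬_; Dec; yes; no)
open import Relation.Nullary.Decidable using (⌊_⌋; isYes≗does; dec-true; dec-false)
open ≡-Reasoning

⌊⌋-true : {P : Set} (d : Dec P) → P → ⌊ d ⌋ ≡ true
⌊⌋-true d p = trans (isYes≗does d) (dec-true d p)

⌊⌋-false : {P : Set} (d : Dec P) → ¬ P → ⌊ d ⌋ ≡ false
⌊⌋-false d ¬p = trans (isYes≗does d) (dec-false d ¬p)

𝟙 : {P : Set} → Dec P → ℤ
𝟙 d = if ⌊ d ⌋ then 1ℤ else 0ℤ

𝟙-yes : {P : Set} (d : Dec P) → P → 𝟙 d ≡ 1ℤ
𝟙-yes d p rewrite ⌊⌋-true d p = refl

𝟙-no : {P : Set} (d : Dec P) → ¬ P → 𝟙 d ≡ 0ℤ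
𝟙-no d ¬p rewrite ⌊⌋-false d ¬p = refl

𝟙-≤?-zero : ∀ a → 𝟙 (a ≟ 0) ≡ 𝟙 (a ≤? 0)
𝟙-≤?-zero zero    = refl
𝟙-≤?-zero (suc a) = refl

𝟙-≤?-suc : ∀ a i → 𝟙 (a ≤? i) ℤ.+ 𝟙 (a ≟ suc i) ≡ 𝟙 (a ≤? suc i)
𝟙-≤?-suc a i with <-cmp a (suc i)
... | tri< a<1+i _ _
  rewrite 𝟙-yes (a ≤? i) (≤-pred a<1+i) | 𝟙-no (a ≟ suc i) (<⇒≢ a<1+i) | 𝟙-yes (a ≤? suc i) (<⇒≤ a<1+i) = refl
... | tri≈ _ refl _
  rewrite 𝟙-no (suc i ≤? i) 1+n≰n | 𝟙-yes (suc i ≟ suc i) refl | 𝟙-yes (suc i ≤? suc i) ≤-refl = refl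
... | tri> _ _ 1+i<a
  rewrite 𝟙-no (a ≤? i) (<⇒≱ (<-trans (n<1+n i) 1+i<a)) | 𝟙-no (a ≟ suc i) (>⇒≢ 1+i<a)
        | 𝟙-no (a ≤? suc i) (<⇒≱ 1+i<a) = refl

crossing : ℕ → ℕ → ℕ → ℤ
crossing i a b = 𝟙 (a ≟ suc i) ℤ.* 𝟙 (b ≟ i) - 𝟙 (a ≟ i) ℤ.* 𝟙 (b ≟ suc i)

crossing-refl : ∀ i a → crossing i a a ≡ 𝟙 (a ≤? i) - 𝟙 (a ≤? i)
crossing-refl i a = trans (i≡j⇒i-j≡0 (*-comm (𝟙 (a ≟ suc i)) (𝟙 (a ≟ i)))) (sym (+-inverseʳ (𝟙 (a ≤? i))))

crossing-sucʳ : ∀ i a → crossing i a (suc a) ≡ 𝟙 (suc a ≤? i) - 𝟙 (a ≤? i)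
crossing-sucʳ i a with <-cmp a i
... | tri< a<i _ _
  rewrite 𝟙-no (a ≟ suc i) (<⇒≢ (m<n⇒m<1+n a<i)) | 𝟙-no (a ≟ i) (<⇒≢ a<i)
        | 𝟙-yes (suc a ≤? i) a<i | 𝟙-yes (a ≤? i) (<⇒≤ a<i) = refl
... | tri≈ _ refl _
  rewrite 𝟙-no (a ≟ suc a) (<⇒≢ (n<1+n a)) | 𝟙-yes (a ≟ a) refl | 𝟙-yes (suc a ≟ suc a) refl
        | 𝟙-no (suc a ≤? a) 1+n≰n | 𝟙-yes (a ≤? a) ≤-refl = refl
... | tri> _ _ i<a
  rewrite 𝟙-no (suc a ≟ i) (>⇒≢ (m<n⇒m<1+n i<a)) | 𝟙-no (a ≟ i) (>⇒≢ i<a) | *-zeroʳ (𝟙 (a ≟ suc i))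
        | 𝟙-no (suc a ≤? i) (<⇒≱ (m<n⇒m<1+n i<a)) | 𝟙-no (a ≤? i) (<⇒≱ i<a) = refl

crossing-sucˡ : ∀ i b → crossing i (suc b) b ≡ 𝟙 (b ≤? i) - 𝟙 (suc b ≤? i)
crossing-sucˡ i b with <-cmp b i
... | tri< b<i _ _
  rewrite 𝟙-no (suc b ≟ suc i) (<⇒≢ (s≤s b<i)) | 𝟙-no (b ≟ suc i) (<⇒≢ (m<n⇒m<1+n b<i))
        | *-zeroʳ (𝟙 (suc b ≟ i)) | 𝟙-yes (b ≤? i) (<⇒≤ b<i) | 𝟙-yes (suc b ≤? i) b<i = refl
... | tri≈ _ refl _
  rewrite 𝟙-yes (suc b ≟ suc b) refl | 𝟙-yes (b ≟ b) refl | 𝟙-no (suc b ≟ b) (>⇒≢ (n<1+n b))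
        | 𝟙-yes (b ≤? b) ≤-refl | 𝟙-no (suc b ≤? b) 1+n≰n = refl
... | tri> _ _ i<b
  rewrite 𝟙-no (b ≟ i) (>⇒≢ i<b) | 𝟙-no (suc b ≟ i) (>⇒≢ (m<n⇒m<1+n i<b)) | *-zeroʳ (𝟙 (suc b ≟ suc i))
        | 𝟙-no (b ≤? i) (<⇒≱ i<b) | 𝟙-no (suc b ≤? i) (<⇒≱ (m<n⇒m<1+n i<b)) = refl

crossing-neighbours : ∀ i {a b} → b ≤ suc a → a ≤ suc b → crossing i a b ≡ 𝟙 (b ≤? i) - 𝟙 (a ≤? i)
crossing-neighbours i {a} {b} b≤1+a a≤1+b with m≤n⇒m<n∨m≡n b≤1+a | m≤n⇒m<n∨m≡n a≤1+b
... | inj₂ refl  | _          = crossing-sucʳ i a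
... | inj₁ _     | inj₂ refl  = crossing-sucˡ i b
... | inj₁ b<1+a | inj₁ a<1+b with ≤-antisym (≤-pred b<1+a) (≤-pred a<1+b)
...   | refl = crossing-refl i a

masked-difference : ∀ {P : Set} u v p q (d : Dec P) → (P → u - v ≡ p - q) →
  u ℤ.* 𝟙 d - v ℤ.* 𝟙 d ≡ p ℤ.* 𝟙 d - q ℤ.* 𝟙 d
masked-difference u v p q (yes holds) eq
  rewrite *-identityʳ u | *-identityʳ v | *-identityʳ p | *-identityʳ q = eq holds
masked-difference u v p q (no _) _
  rewrite *-zeroʳ u | *-zeroʳ v | *-zeroʳ p | *-zeroʳ q = refl

sumℤ-zero : ∀ {m} (f : Fin m → ℤ) → (∀ w → f w ≡ 0ℤ) → sumℤ f ≡ 0ℤ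
sumℤ-zero {zero}  f f≡0 = refl
sumℤ-zero {suc m} f f≡0 rewrite f≡0 Fin.zero =
  trans (+-identityˡ _) (sumℤ-zero (λ k → f (Fin.suc k)) (λ k → f≡0 (Fin.suc k)))

sumℤ-single : ∀ {m} (f : Fin m → ℤ) y → (∀ w → w ≢ y → f w ≡ 0ℤ) → sumℤ f ≡ f y
sumℤ-single f Fin.zero f≡0
  rewrite sumℤ-zero (λ k → f (Fin.suc k)) (λ k → f≡0 (Fin.suc k) λ ()) = +-identityʳ (f Fin.zero)
sumℤ-single f (Fin.suc y) f≡0
  rewrite f≡0 Fin.zero (λ ()) = trans (+-identityˡ _)
    (sumℤ-single (λ k → f (Fin.suc k)) y (λ w w≢y → f≡0 (Fin.suc w) (w≢y ∘ Fin.suc-injective)))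

anyFin-intro : ∀ {m} (f : Fin m → Bool) w → f w ≡ true → anyFin f ≡ true
anyFin-intro f Fin.zero    fw rewrite fw = refl
anyFin-intro f (Fin.suc w) fw rewrite anyFin-intro (λ k → f (Fin.suc k)) w fw = ∨-zeroʳ (f Fin.zero)

anyFin-elim : ∀ {m} (f : Fin m → Bool) → anyFin f ≡ true → ∃ λ w → f w ≡ true
anyFin-elim {suc m} f any with f Fin.zero in f0
... | true  = Fin.zero , f0
... | false with anyFin-elim (λ k → f (Fin.suc k)) any
...   | w , fw = Fin.suc w , fw

module _ (Γ : Graph) where
  open Graph Γ using (n; Adj)

  search-≤ : ∀ p s f {k} → s ≤ k → p k ≡ true → search Γ p s f ≤ k
  search-≤ p s zero    s≤k pk = s≤k
  search-≤ p s (suc f) s≤k pk with p s in ps | m≤n⇒m<n∨m≡n s≤k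
  ... | true  | _          = s≤k
  ... | false | inj₁ s<k   = search-≤ p (suc s) f s<k pk
  ... | false | inj₂ refl  with () ← trans (sym ps) pk

  search-≤-bound : ∀ p s f → search Γ p s f ≤ s + f
  search-≤-bound p s zero    = ≤-reflexive (sym (ℕ.+-identityʳ s))
  search-≤-bound p s (suc f) with p s
  ... | true  = ℕ.m≤m+n s (suc f)
  ... | false = ≤-trans (search-≤-bound p (suc s) f) (≤-reflexive (sym (ℕ.+-suc s f)))

  search-found : ∀ p s f → search Γ p s f < s + f → p (search Γ p s f) ≡ true
  search-found p s zero    s<s+0 = ⊥-elim (ℕ.<-irrefl (sym (ℕ.+-identityʳ s)) s<s+0)
  search-found p s (suc f) found with p s in ps
  ... | true  = ps
  ... | false = search-found p (suc s) f (ℕ.<-≤-trans found (≤-reflexive (ℕ.+-suc s f)))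

  search-cong : ∀ {p q} s f → (∀ k → p k ≡ q k) → search Γ p s f ≡ search Γ q s f
  search-cong s zero    p≗q = refl
  search-cong s (suc f) p≗q rewrite p≗q s = cong (if _ then s else_) (search-cong (suc s) f p≗q)

  walk-zero : ∀ {y z} → walk Γ 0 y z ≡ true → y ≡ z
  walk-zero {y} {z} w with y Fin.≟ z | w
  ... | yes y≡z | _ = y≡z
  ... | no _    | ()

  walk-cons : ∀ k {y w z} → Adj y w ≡ true → walk Γ k w z ≡ true → walk Γ (suc k) y z ≡ true
  walk-cons k {y} {w} {z} a p = anyFin-intro (λ v → Adj y v ∧ walk Γ k v z) w (cong₂ _∧_ a p)

  walk-uncons : ∀ k {y z} → walk Γ (suc k) y z ≡ true → ∃ λ w → Adj y w ≡ true × walk Γ k w z ≡ true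
  walk-uncons k {y} {z} p with anyFin-elim (λ v → Adj y v ∧ walk Γ k v z) p
  ... | w , q = w , ∧-conicalˡ _ _ q , ∧-conicalʳ _ _ q

  walk-snoc : ∀ k {y w z} → walk Γ k y w ≡ true → Adj w z ≡ true → walk Γ (suc k) y z ≡ true
  walk-snoc zero    {z = z} p a with refl ← walk-zero p = walk-cons 0 a (⌊⌋-true (z Fin.≟ z) refl)
  walk-snoc (suc k) p a with walk-uncons k p
  ... | v , a′ , q = walk-cons (suc k) a′ (walk-snoc k q a)

  walk-reverse : ∀ k {y z} → walk Γ k y z ≡ true → walk Γ k z y ≡ true
  walk-reverse zero    {y} p with refl ← walk-zero p = ⌊⌋-true (y Fin.≟ y) refl
  walk-reverse (suc k) {y} p with walk-uncons k p
  ... | v , a , q = walk-snoc k (walk-reverse k q) (trans (Graph.sym Γ v y) a)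

  dist-≤-n : ∀ y z → dist Γ y z ≤ n
  dist-≤-n y z = search-≤-bound (λ k → walk Γ k y z) 0 n

  dist-walk : ∀ {y z} → dist Γ y z < n → walk Γ (dist Γ y z) y z ≡ true
  dist-walk {y} {z} = search-found (λ k → walk Γ k y z) 0 n

  dist-minimal : ∀ k {y z} → walk Γ k y z ≡ true → dist Γ y z ≤ k
  dist-minimal k {y} {z} = search-≤ (λ k → walk Γ k y z) 0 n z≤n

  dist-sym : ∀ y z → dist Γ y z ≡ dist Γ z y
  dist-sym y z = search-cong 0 n λ k → ⇔→≡ {z = true} (mk⇔ (walk-reverse k) (walk-reverse k))

  dist-adjacent : ∀ {y w} z → Adj y w ≡ true → dist Γ y z ≤ suc (dist Γ w z)
  dist-adjacent {w = w} z a with m≤n⇒m<n∨m≡n (dist-≤-n w z)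
  ... | inj₁ d<n = dist-minimal (suc (dist Γ w z)) (walk-cons (dist Γ w z) a (dist-walk d<n))
  ... | inj₂ d≡n = ≤-trans (dist-≤-n _ z) (≤-trans (≤-reflexive (sym d≡n)) (n≤1+n _))

  dist-neighbours : ∀ {x z} y → Adj x z ≡ true → dist Γ y z ≤ suc (dist Γ x y) × dist Γ x y ≤ suc (dist Γ y z)
  dist-neighbours {x} {z} y x~z =
    subst (_≤ suc (dist Γ x y)) (dist-sym z y) (dist-adjacent y (trans (Graph.sym Γ z x) x~z)) ,
    subst (λ d → dist Γ x y ≤ suc d) (dist-sym z y) (dist-adjacent y x~z)

  diameter-≤-n : ∀ {D} → IsDiameter Γ D → D ≤ n
  diameter-≤-n (_ , y , z , dist≡D) = subst (_≤ n) dist≡D (dist-≤-n y z)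

  dist≡1⇒adjacent : 1 < n → ∀ {y z} → dist Γ y z ≡ 1 → Adj y z ≡ true
  dist≡1⇒adjacent 1<n {y} {z} d≡1
    with walk-uncons 0 (subst (λ k → walk Γ k y z ≡ true) d≡1 (dist-walk (subst (_< n) (sym d≡1) 1<n)))
  ... | w , a , q with refl ← walk-zero q = a

  Estar-diagonal : ∀ x k y → Estar Γ x k y y ≡ 𝟙 (dist Γ x y ≟ k)
  Estar-diagonal x k y rewrite ⌊⌋-true (y Fin.≟ y) refl = refl

  Estar-·ˡ : ∀ x k (M : Mat Γ) y z → _·_ Γ (Estar Γ x k) M y z ≡ 𝟙 (dist Γ x y ≟ k) ℤ.* M y z
  Estar-·ˡ x k M y z =
    trans (sumℤ-single (λ w → Estar Γ x k y w ℤ.* M w z) y off-diagonal) (cong (ℤ._* M y z) (Estar-diagonal x k y))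
    where
    off-diagonal : ∀ w → w ≢ y → Estar Γ x k y w ℤ.* M w z ≡ 0ℤ
    off-diagonal w w≢y rewrite ⌊⌋-false (y Fin.≟ w) (w≢y ∘ sym) = refl

  ·-Estarʳ : ∀ x k (M : Mat Γ) y z → _·_ Γ M (Estar Γ x k) y z ≡ M y z ℤ.* 𝟙 (dist Γ x z ≟ k)
  ·-Estarʳ x k M y z =
    trans (sumℤ-single (λ w → M y w ℤ.* Estar Γ x k w z) z off-diagonal) (cong (M y z ℤ.*_) (Estar-diagonal x k z))
    where
    off-diagonal : ∀ w → w ≢ z → M y w ℤ.* Estar Γ x k w z ≡ 0ℤ
    off-diagonal w w≢z rewrite ⌊⌋-false (w Fin.≟ z) w≢z = *-zeroʳ (M y w)

  sumTo-·-Estarʳ : ∀ x k i (M : ℕ → Mat Γ) y z →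
    sumTo Γ i (λ h → _·_ Γ (M h) (Estar Γ x k)) y z ≡ sumTo Γ i M y z ℤ.* 𝟙 (dist Γ x z ≟ k)
  sumTo-·-Estarʳ x k zero    M y z = ·-Estarʳ x k (M 0) y z
  sumTo-·-Estarʳ x k (suc i) M y z =
    trans (cong₂ ℤ._+_ (sumTo-·-Estarʳ x k i M y z) (·-Estarʳ x k (M (suc i)) y z))
          (sym (*-distribʳ-+ (𝟙 (dist Γ x z ≟ k)) (sumTo Γ i M y z) (M (suc i) y z)))

  sumTo-indicator : ∀ i (M : ℕ → Mat Γ) {y z} a → (∀ h → M h y z ≡ 𝟙 (a ≟ h)) → sumTo Γ i M y z ≡ 𝟙 (a ≤? i)
  sumTo-indicator zero    M a M≡𝟙 = trans (M≡𝟙 0) (𝟙-≤?-zero a)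
  sumTo-indicator (suc i) M a M≡𝟙 =
    trans (cong₂ ℤ._+_ (sumTo-indicator i M a M≡𝟙) (M≡𝟙 (suc i))) (𝟙-≤?-suc a i)

  sumTo-A : ∀ i y z → sumTo Γ i (A Γ) y z ≡ 𝟙 (dist Γ y z ≤? i)
  sumTo-A i y z = sumTo-indicator i (A Γ) (dist Γ y z) λ _ → refl

  sumTo-Estar-J : ∀ x i y z → sumTo Γ i (λ h → _·_ Γ (Estar Γ x h) (J Γ)) y z ≡ 𝟙 (dist Γ x y ≤? i)
  sumTo-Estar-J x i y z =
    sumTo-indicator i _ (dist Γ x y) λ h → trans (Estar-·ˡ x h (J Γ) y z) (*-identityʳ _)

  Estar-A-difference : 1 < n → ∀ i {x} y {z} → dist Γ x z ≡ 1 →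
    _·_ Γ (Estar Γ x (suc i)) (A Γ i) y z - _·_ Γ (Estar Γ x i) (A Γ (suc i)) y z
    ≡ 𝟙 (dist Γ y z ≤? i) - 𝟙 (dist Γ x y ≤? i)
  Estar-A-difference 1<n i {x} y {z} xz≡1 = begin
    _·_ Γ (Estar Γ x (suc i)) (A Γ i) y z - _·_ Γ (Estar Γ x i) (A Γ (suc i)) y z
      ≡⟨ cong₂ _-_ (Estar-·ˡ x (suc i) (A Γ i) y z) (Estar-·ˡ x i (A Γ (suc i)) y z) ⟩
    crossing i (dist Γ x y) (dist Γ y z)
      ≡⟨ uncurry (crossing-neighbours i) (dist-neighbours y (dist≡1⇒adjacent 1<n xz≡1)) ⟩
    𝟙 (dist Γ y z ≤? i) - 𝟙 (dist Γ x y ≤? i) ∎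

lemma3p2 : (Γ : Graph) → DistanceRegular Γ → (D : ℕ) → IsDiameter Γ D → 3 ≤ D →
    (x : Fin (Graph.n Γ)) → (i : ℕ) → i < D →
    (y z : Fin (Graph.n Γ)) →
      _⊖_ Γ (_·_ Γ (_·_ Γ (Estar Γ x (suc i)) (A Γ i)) (Estar Γ x 1))
            (_·_ Γ (_·_ Γ (Estar Γ x i) (A Γ (suc i))) (Estar Γ x 1)) y z
      ≡ _⊖_ Γ (sumTo Γ i (λ h → _·_ Γ (A Γ h) (Estar Γ x 1)))
              (sumTo Γ i (λ h → _·_ Γ (_·_ Γ (Estar Γ x h) (J Γ)) (Estar Γ x 1))) y z
lemma3p2 Γ _ D diameter 3≤D x i _ y z = begin
    _·_ Γ M₁ E₁ y z - _·_ Γ M₂ E₁ y z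
      ≡⟨ cong₂ _-_ (·-Estarʳ Γ x 1 M₁ y z) (·-Estarʳ Γ x 1 M₂ y z) ⟩
    M₁ y z ℤ.* 𝟙 (dist Γ x z ≟ 1) - M₂ y z ℤ.* 𝟙 (dist Γ x z ≟ 1)
      ≡⟨ masked-difference (M₁ y z) (M₂ y z) (S₁ y z) (S₂ y z) (dist Γ x z ≟ 1) at-neighbour ⟩
    S₁ y z ℤ.* 𝟙 (dist Γ x z ≟ 1) - S₂ y z ℤ.* 𝟙 (dist Γ x z ≟ 1)
      ≡⟨ cong₂ _-_ (sumTo-·-Estarʳ Γ x 1 i (A Γ) y z) (sumTo-·-Estarʳ Γ x 1 i E·J y z) ⟨
    sumTo Γ i (λ h → _·_ Γ (A Γ h) E₁) y z - sumTo Γ i (λ h → _·_ Γ (E·J h) E₁) y z ∎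
  where
  E·J : ℕ → Mat Γ
  E·J h = _·_ Γ (Estar Γ x h) (J Γ)

  E₁ M₁ M₂ S₁ S₂ : Mat Γ
  E₁ = Estar Γ x 1
  M₁ = _·_ Γ (Estar Γ x (suc i)) (A Γ i)
  M₂ = _·_ Γ (Estar Γ x i) (A Γ (suc i))
  S₁ = sumTo Γ i (A Γ)
  S₂ = sumTo Γ i E·J

  1<n : 1 < Graph.n Γ
  1<n = ≤-trans (s≤s (s≤s z≤n)) (≤-trans 3≤D (diameter-≤-n Γ diameter))

  at-neighbour : dist Γ x z ≡ 1 → M₁ y z - M₂ y z ≡ S₁ y z - S₂ y z
  at-neighbour xz≡1 =
    trans (Estar-A-difference Γ 1<n i y xz≡1) (sym (cong₂ _-_ (sumTo-A Γ i y z) (sumTo-Estar-J Γ x i y z)))
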